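{- Let $G=(V,E)$ be a simple graph with maximum degree $\Delta$, and let the Walk-on-Kempe-Path (WKP) algorithm be run on an initial consistent coloring of the links of the incidence graph $G^*$ with $\Delta$ colors. Then the algorithm returns either a proper $\Delta$-edge-coloring or a canonical configuration, and its running time is $O(|V||E|^2)$.
   Context: The incidence graph $G^*$ of $G$ is obtained by placing a fictitious vertex $e^*_{i,j}$ in the middle of each edge $e_{i,j}=v_iv_j$, so that each edge consists of two links $l_{i,j}=(v_i,e^*_{i,j})$, $l_{j,i}=(v_j,e^*_{i,j})$. A coloring (configuration) assigns a color from $C=\{c_1,\dots,c_\Delta\}$ to each link; the colored edge is $\vec e_{i,j}=(c(l_{i,j}),c(l_{j,i}))$, a constant if the two colors coincide and a variable otherwise. A coloring is consistent if the links at each vertex $v\in V$ have pairwise distinct colors, and proper if it is consistent and all colored edges are constants (this is a proper $\Delta$-edge-coloring of $G$). For $\alpha\ne\beta$, an $(\alpha,\beta)$ path is a sequence of adjacent links with colors in $\{\alpha,\beta\}$; a maximal one is either closed (a cycle) or open. A color exchange at a vertex $v_i$ between two incident edges swaps the colors of the two links at $v_i$. A Kempe walk of an $(\alpha,\beta)$ variable is a sequence of color exchanges along the interior vertices of an $(\alpha,\beta)$ path that moves the variable along the path without increasing the number of variables; it eliminates the variable when it meets another variable on the path or reaches an end of an open path (a fictitious vertex, or a vertex missing an $\alpha$ or $\beta$ link). The WKP algorithm: maintain the list of variable edges; if it is empty, return the properly colored graph. Otherwise, for each variable $\vec e_{i,j}=(\alpha,\beta)$ in the list, search from $v_i$ along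 the $(\alpha,\beta)$ path until (1) another variable is found, (2) the path terminates at a vertex missing an $\alpha$ or $\beta$ link, or (3) the path returns to $v_j$, forming a cycle; in case (3) proceed to the next variable; otherwise perform the color exchanges on the interior chain of the found path (eliminating at least one variable), update the list and restart. If no variable in the list can be eliminated this way, return the current configuration. A configuration is canonical if no variable can be further reduced by single-variable Kempe walks. -}

module Defs where

open import Data.Nat using (ℕ; zero; suc; _+_; _⊔_)
open import Data.Fin using (Fin)
import Data.Fin.Properties as FinP
open import Data.Bool using (Bool; true; false; if_then_else_; not; _∧_)
open import Data.List using (List; []; _∷_; map; filterᵇ; allFin; length; foldr; head)
open import Data.Bool.ListAction using (any)
open import Data.Maybe using (Maybe; just; nothing)
open import Data.Product using (_×_; _,_; proj₁; proj₂; ∃-syntax)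
open import Data.Sum using (_⊎_)
open import Relation.Nullary using (¬_; does)
open import Relation.Binary.PropositionalEquality using (_≡_; _≢_)

-- Each edge k has two ends (sides src / tgt); the pair (k , s) is the
-- link l_{k,s} of the incidence graph G* joining the vertex  ends k s
-- to the fictitious middle vertex e*_k.

data Side : Set where
  src tgt : Side

flip : Side → Side
flip src = tgt
flip tgt = src

_≟S_ : Side → Side → Bool
src ≟S src = true
tgt ≟S tgt = true
_   ≟S _   = false

record Graph (n m : ℕ) : Set where
  field
    ends : Fin m → Side → Fin n
open Graph public

Simple : ∀ {n m} → Graph n m → Set
Simple {n} {m} G =
  (∀ k → ends G k src ≢ ends G k tgt) ×
  (∀ k k' → (∀ s → ∃[ s' ] ends G k s ≡ ends G k' s') → k ≡ k')

Link : ℕ → Set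
Link m = Fin m × Side

allLinks : ∀ m → List (Link m)
allLinks m = foldr (λ k ls → (k , src) ∷ (k , tgt) ∷ ls) [] (allFin m)

_≟F_ : ∀ {m} → Fin m → Fin m → Bool
a ≟F b = does (a FinP.≟ b)

_≟L_ : ∀ {m} → Link m → Link m → Bool
(k , s) ≟L (k' , s') = (k ≟F k') ∧ (s ≟S s')

vtx : ∀ {n m} → Graph n m → Link m → Fin n
vtx G (k , s) = ends G k s

-- degree of v = number of links at v (= number of incident edges, G loopless)
deg : ∀ {n m} → Graph n m → Fin n → ℕ
deg {n} {m} G v = length (filterᵇ (λ l → vtx G l ≟F v) (allLinks m))

Δ : ∀ {n m} → Graph n m → ℕ
Δ {n} G = foldr _⊔_ 0 (map (deg G) (allFin n))

Config : ∀ {n m} → Graph n m → Set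
Config {n} {m} G = Link m → Fin (Δ G)

Consistent : ∀ {n m} (G : Graph n m) → Config G → Set
Consistent {n} {m} G c =
  ∀ (l l' : Link m) → l ≢ l' → vtx G l ≡ vtx G l' → c l ≢ c l'

Variable : ∀ {n m} (G : Graph n m) → Config G → Fin m → Set
Variable G c k = c (k , src) ≢ c (k , tgt)

Proper : ∀ {n m} (G : Graph n m) → Config G → Set
Proper {n} {m} G c = Consistent G c × (∀ k → ¬ Variable G c k)

-- ReachEnd G c k w b a : walking from vertex w along the (a,b) path,
-- where the next link needed at w has color b (and the one after it
-- color a), one reaches, without passing through the edge k itself,
--   * a vertex missing a b-link, or
--   * an edge f whose far link is not colored b (i.e. a fictitious
--     vertex ending the path: another (a,b)-variable, or an end of the
--     open path),
-- possibly after following constant b-colored edges.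

data ReachEnd {n m} (G : Graph n m) (c : Config G) (k : Fin m)
              : Fin n → Fin (Δ G) → Fin (Δ G) → Set where
  missing : ∀ {w b a} →
            (∀ (l : Link m) → vtx G l ≡ w → c l ≢ b) →
            ReachEnd G c k w b a
  openEnd : ∀ {w b a} (f : Fin m) (s : Side) →
            ends G f s ≡ w → c (f , s) ≡ b → f ≢ k →
            c (f , flip s) ≢ b →
            ReachEnd G c k w b a
  step    : ∀ {w b a} (f : Fin m) (s : Side) →
            ends G f s ≡ w → c (f , s) ≡ b → f ≢ k →
            c (f , flip s) ≡ b →
            ReachEnd G c k (ends G f (flip s)) a b →
            ReachEnd G c k w b a

Reducible : ∀ {n m} (G : Graph n m) → Config G → Fin m → Set
Reducible G c k =
  ReachEnd G c k (ends G k src) (c (k , tgt)) (c (k , src)) ⊎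
  ReachEnd G c k (ends G k tgt) (c (k , src)) (c (k , tgt))

Canonical : ∀ {n m} (G : Graph n m) → Config G → Set
Canonical {n} {m} G c =
  Consistent G c × (∀ k → Variable G c k → ¬ Reducible G c k)

-- Cost model (unit-cost operations): each link inspected while searching
-- along a Kempe path costs 1 (plus 1 per search), each color exchange on
-- a link costs 1, and (re)building the list of variables costs m.

module WKP {n m} (G : Graph n m) where

  Col : Set
  Col = Fin (Δ G)

  _≟C_ : Col → Col → Bool
  a ≟C b = does (a FinP.≟ b)

  findLink : Config G → Fin n → Col → Maybe (Link m)
  findLink c w b =
    head (filterᵇ (λ l → (vtx G l ≟F w) ∧ (c l ≟C b)) (allLinks m))

  data Outcome : Set where
    cycle reduce stuck : Outcome

  -- search from vertex w along the (a,b) path of the variable k,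
  -- next needed color b; returns the outcome and the links traversed
  search : ℕ → Config G → Fin m → Fin n → Col → Col → Outcome × List (Link m)
  search zero     c k w b a = stuck , []
  search (suc fu) c k w b a with findLink c w b
  ... | nothing = reduce , []
  ... | just (f , s) =
        if f ≟F k then (cycle , [])
        else (if c (f , flip s) ≟C b
              then (proj₁ r , (f , s) ∷ (f , flip s) ∷ proj₂ r)
              else (reduce , (f , s) ∷ []))
    where r = search fu c k (ends G f (flip s)) a b

  -- search for the variable k = (α , β), α at the src end, β at the tgt end;
  -- the Kempe path is the link (k , src) followed by the traversed links
  searchVar : Config G → Fin m → Outcome × List (Link m)
  searchVar c k with search (suc m) c k (ends G k src) (c (k , tgt)) (c (k , src))
  ... | o , T = o , (k , src) ∷ T

  exchange : Col → Col → List (Link m) → Config G → Config G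
  exchange α β T c l =
    if any (λ l' → l' ≟L l) T
    then (if c l ≟C α then β else (if c l ≟C β then α else c l))
    else c l

  variables : Config G → List (Fin m)
  variables c = filterᵇ (λ k → not (c (k , src) ≟C c (k , tgt))) (allFin m)

  tryList : Config G → List (Fin m) → Maybe (Config G) × ℕ
  tryList c [] = nothing , 0
  tryList c (k ∷ ks) with searchVar c k
  ... | reduce , P = just (exchange (c (k , src)) (c (k , tgt)) P c) ,
                     (suc (length P) + length P)
  ... | cycle , P = let r = tryList c ks in proj₁ r , suc (length P) + proj₂ r
  ... | stuck , P = let r = tryList c ks in proj₁ r , suc (length P) + proj₂ r

  addCost : ℕ → Maybe (Config G × ℕ) → Maybe (Config G × ℕ)
  addCost t nothing = nothing
  addCost t (just (c , t')) = just (c , t + t')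

  run : ℕ → Config G → Maybe (Config G × ℕ)
  run zero c = nothing
  run (suc fu) c with variables c
  ... | [] = just (c , m)
  ... | k ∷ ks with tryList c (k ∷ ks)
  ...   | nothing , t = just (c , m + t)
  ...   | just c' , t = addCost (m + t) (run fu c')

-- The search of WKP from one end of a variable k = (α , β) explores the (α , β) Kempe chain
-- through k.  Because the colouring is consistent, every vertex of the chain has at most one
-- α-link and one β-link, so the search never revisits a vertex: it traverses at most 2n
-- links and at most m edges, and ends either back at k (a cycle) or at an end of an open
-- path.  In the cycle case the whole chain has been explored and consists of constant
-- edges at vertices carrying both colours, so no Kempe walk from either end of k can
-- terminate: k is irreducible.  In the open case swapping α and β on the explored links
-- keeps the colouring consistent, turns k into a constant and creates no new variable.
-- Hence every round of the main loop either stops in a canonical (or proper)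
-- configuration or strictly decreases the number of variables.  A round searches at most
-- m variables at cost O(n) each, and there are at most m rounds: the total cost is O(n m²).

module Submission where

open import Defs
open import Data.Bool using (Bool; true; false; T; not; if_then_else_; b≤b; f≤t; f<t)
  renaming (_≤_ to _≤ᵇ_; _<_ to _<ᵇ_)
open import Data.Bool.ListAction using (any)
open import Data.Bool.Properties using (T-∧)
open import Data.Empty using (⊥; ⊥-elim)
open import Data.Fin using (Fin) renaming (zero to fzero; suc to fsuc)
import Data.Fin.Properties as Finₚ
open import Data.List using (List; []; _∷_; length; lookup; head; filterᵇ; allFin)
open import Data.List.Membership.Propositional using (_∈_; _∉_; lose)
open import Data.List.Membership.Propositional.Properties
  using (∈-lookup; ∈-allFin; ∈-filter⁺; ∈-filter⁻)
open import Data.List.Properties using (length-filter; length-tabulate)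
open import Data.List.Relation.Unary.All as All using (All)
open import Data.List.Relation.Unary.All.Properties using (¬Any⇒All¬)
open import Data.List.Relation.Unary.AllPairs using ([]; _∷_)
open import Data.List.Relation.Unary.Any as Any using (Any; here; there)
open import Data.List.Relation.Unary.Any.Properties using (any⁺; any⁻)
open import Data.List.Relation.Unary.Unique.Propositional using (Unique)
open import Data.Maybe using (Maybe; just; nothing)
open import Data.Nat using (ℕ; zero; suc; _+_; _*_; _≤_; _<_; z≤n; s≤s; _≤?_)
import Data.Nat.Properties as ℕ
open import Data.Nat.Tactic.RingSolver using (solve-∀)
open import Data.Product using (_×_; _,_; proj₁; proj₂; ∃-syntax)
open import Data.Product.Properties using (≡-dec)
open import Data.Sum using (_⊎_; inj₁; inj₂)
open import Function using (_∘_; id)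
open import Function.Bundles using (Equivalence; _⇔_; mk⇔)
open import Relation.Nullary using (¬_; Dec; yes; no; does; contradiction)
open import Relation.Nullary.Decidable using (dec-true; dec-false; T?)
open import Relation.Binary.PropositionalEquality
  using (_≡_; _≢_; refl; sym; trans; cong; cong₂; subst)

module _ {A : Set} where

  lookup-injective : {xs : List A} → Unique xs → ∀ i j → lookup xs i ≡ lookup xs j → i ≡ j
  lookup-injective (_ ∷ _)  fzero    fzero    _  = refl
  lookup-injective (x≢ ∷ _) fzero    (fsuc j) eq = contradiction eq (All.lookup x≢ (∈-lookup j))
  lookup-injective (x≢ ∷ _) (fsuc i) fzero    eq = contradiction (sym eq) (All.lookup x≢ (∈-lookup i))
  lookup-injective (_ ∷ u)  (fsuc i) (fsuc j) eq = cong fsuc (lookup-injective u i j eq)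

  head-just⇒∈ : ∀ {xs : List A} {x} → head xs ≡ just x → x ∈ xs
  head-just⇒∈ {_ ∷ _} refl = here refl

  head-nothing⇒∉ : ∀ {xs : List A} {x} → head xs ≡ nothing → x ∉ xs
  head-nothing⇒∉ {[]} _ ()

unique⇒length≤ : ∀ {N} {xs : List (Fin N)} → Unique xs → length xs ≤ N
unique⇒length≤ {N} {xs} u with length xs ≤? N
... | yes ≤N = ≤N
... | no ≰N with Finₚ.pigeonhole (ℕ.≰⇒> ≰N) (lookup xs)
... | i , j , i<j , eq = contradiction (lookup-injective u i j eq) (Finₚ.<⇒≢ i<j)

module _ {A : Set} (p q : A → Bool) where

  length-filterᵇ-mono : (∀ x → p x ≤ᵇ q x) → ∀ xs →
                        length (filterᵇ p xs) ≤ length (filterᵇ q xs)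
  length-filterᵇ-mono p≤q [] = z≤n
  length-filterᵇ-mono p≤q (x ∷ xs) with p x | q x | p≤q x
  ... | false | true  | f≤t = ℕ.m≤n⇒m≤1+n (length-filterᵇ-mono p≤q xs)
  ... | false | false | b≤b = length-filterᵇ-mono p≤q xs
  ... | true  | true  | b≤b = s≤s (length-filterᵇ-mono p≤q xs)

  length-filterᵇ-< : (∀ x → p x ≤ᵇ q x) → ∀ {xs} → Any (λ x → p x <ᵇ q x) xs →
                     length (filterᵇ p xs) < length (filterᵇ q xs)
  length-filterᵇ-< p≤q {x ∷ xs} (here px<qx) with p x | q x | px<qx
  ... | false | true | f<t = s≤s (length-filterᵇ-mono p≤q xs)
  length-filterᵇ-< p≤q {x ∷ xs} (there any) with p x | q x | p≤q x
  ... | false | true  | f≤t = ℕ.m≤n⇒m≤1+n (length-filterᵇ-< p≤q any)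
  ... | false | false | b≤b = length-filterᵇ-< p≤q any
  ... | true  | true  | b≤b = s≤s (length-filterᵇ-< p≤q any)

module _ {A : Set} where

  T-does⁻ : (a? : Dec A) → T (does a?) → A
  T-does⁻ (yes a) _ = a

  T-does⁺ : (a? : Dec A) → A → T (does a?)
  T-does⁺ (yes _) _ = _
  T-does⁺ (no ¬a) a = ¬a a

  T-not-does⁻ : (a? : Dec A) → T (not (does a?)) → ¬ A
  T-not-does⁻ (no ¬a) _ = ¬a

  T-not-does⁺ : (a? : Dec A) → ¬ A → T (not (does a?))
  T-not-does⁺ (yes a) ¬a = ¬a a
  T-not-does⁺ (no _)  _  = _

module _ {A B : Set} where

  not-does-mono : (a? : Dec A) (b? : Dec B) → (B → A) → not (does a?) ≤ᵇ not (does b?)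
  not-does-mono (yes _) (yes _) _   = b≤b
  not-does-mono (yes _) (no _)  _   = f≤t
  not-does-mono (no ¬a) (yes b) b→a = contradiction (b→a b) ¬a
  not-does-mono (no _)  (no _)  _   = b≤b

  not-does-< : (a? : Dec A) (b? : Dec B) → A → ¬ B → not (does a?) <ᵇ not (does b?)
  not-does-< (yes _) (no _)  _ _  = f<t
  not-does-< (no ¬a) _       a _  = contradiction a ¬a
  not-does-< (yes _) (yes b) _ ¬b = contradiction b ¬b

_≟Side_ : (s t : Side) → Dec (s ≡ t)
src ≟Side src = yes refl
tgt ≟Side tgt = yes refl
src ≟Side tgt = no λ ()
tgt ≟Side src = no λ ()

_≟Link_ : ∀ {m} (l l' : Link m) → Dec (l ≡ l')
_≟Link_ = ≡-dec Finₚ._≟_ _≟Side_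

≟S-sound : ∀ s t → T (s ≟S t) → s ≡ t
≟S-sound src src _ = refl
≟S-sound tgt tgt _ = refl

≟S-refl : ∀ s → T (s ≟S s)
≟S-refl src = _
≟S-refl tgt = _

≟L-sound : ∀ {m} (l l' : Link m) → T (l ≟L l') → l ≡ l'
≟L-sound (k , s) (k' , s') t with Equivalence.to T-∧ t
... | k≡k' , s≡s' = cong₂ _,_ (T-does⁻ (k Finₚ.≟ k') k≡k') (≟S-sound s s' s≡s')

≟L-refl : ∀ {m} (l : Link m) → T (l ≟L l)
≟L-refl (k , s) = Equivalence.from T-∧ (T-does⁺ (k Finₚ.≟ k) refl , ≟S-refl s)

∈⇔any-≟L : ∀ {m} {l : Link m} {P} → l ∈ P ⇔ T (any (_≟L l) P)
∈⇔any-≟L {l = l} {P} = mk⇔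
  (λ l∈P → any⁺ (_≟L l) (Any.map (λ { refl → ≟L-refl l }) l∈P))
  (λ t → Any.map (λ {l'} t' → sym (≟L-sound l' l t')) (any⁻ (_≟L l) P t))

side-cases : ∀ s t → t ≡ s ⊎ t ≡ flip s
side-cases src src = inj₁ refl
side-cases tgt tgt = inj₁ refl
side-cases src tgt = inj₂ refl
side-cases tgt src = inj₂ refl

allLinks-complete : ∀ {m} (l : Link m) → l ∈ allLinks m
allLinks-complete {m} (k , s) = go s (allFin m) (∈-allFin k)
  where
  go : ∀ s ks → k ∈ ks → (k , s) ∈ Data.List.foldr (λ k' ls → (k' , src) ∷ (k' , tgt) ∷ ls) [] ks
  go src (_ ∷ _) (here refl) = here refl
  go tgt (_ ∷ _) (here refl) = there (here refl)
  go s   (_ ∷ ks) (there k∈) = there (there (go s ks k∈))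

module Kempe {n m} (G : Graph n m) (simple : Simple G) (c : Config G) (consistent : Consistent G c) where
  open WKP G

  link-unique : ∀ l l' → vtx G l ≡ vtx G l' → c l ≡ c l' → l ≡ l'
  link-unique l l' ev ec with l ≟Link l'
  ... | yes l≡l' = l≡l'
  ... | no  l≢l' = contradiction ec (consistent l l' l≢l' ev)

  findLink-just : ∀ w b {l} → findLink c w b ≡ just l → vtx G l ≡ w × c l ≡ b
  findLink-just w b {l} eq with ∈-filter⁻ _ {xs = allLinks m} (head-just⇒∈ eq)
  ... | _ , t with Equivalence.to T-∧ t
  ...   | at-w , coloured-b = T-does⁻ (vtx G l Finₚ.≟ w) at-w , T-does⁻ (c l Finₚ.≟ b) coloured-b

  findLink-nothing : ∀ w b → findLink c w b ≡ nothing → ∀ l → vtx G l ≡ w → c l ≢ b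
  findLink-nothing w b eq l refl refl =
    head-nothing⇒∉ eq (∈-filter⁺ _ (allLinks-complete l)
      (Equivalence.from T-∧ (T-does⁺ (vtx G l Finₚ.≟ vtx G l) refl , T-does⁺ (c l Finₚ.≟ c l) refl)))

  loopless : ∀ f s → ends G f (flip s) ≢ ends G f s
  loopless f src e = proj₁ simple f (sym e)
  loopless f tgt e = proj₁ simple f e

  both-sides⇒src : ∀ f s {x} → c (f , s) ≡ x → c (f , flip s) ≡ x → c (f , src) ≡ x
  both-sides⇒src f src e _ = e
  both-sides⇒src f tgt _ e = e

  both-sides⇒constant : ∀ f s {x} → c (f , s) ≡ x → c (f , flip s) ≡ x → c (f , src) ≡ c (f , tgt)
  both-sides⇒constant f src e e' = trans e (sym e')
  both-sides⇒constant f tgt e e' = trans e' (sym e)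

  constant-flip : ∀ g t → c (g , src) ≡ c (g , tgt) → c (g , flip t) ≡ c (g , t)
  constant-flip g src e = sym e
  constant-flip g tgt e = e

  module Walk (k : Fin m) (var : Variable G c k) where

    α β : Col
    α = c (k , src)
    β = c (k , tgt)

    αβ : Col → Set
    αβ z = z ≡ α ⊎ z ≡ β

    Pair : Col → Col → Set
    Pair x y = (x ≡ α × y ≡ β) ⊎ (x ≡ β × y ≡ α)

    pair-sym : ∀ {x y} → Pair x y → Pair y x
    pair-sym (inj₁ (p , q)) = inj₂ (q , p)
    pair-sym (inj₂ (p , q)) = inj₁ (q , p)

    pair-≢ : ∀ {x y} → Pair x y → x ≢ y
    pair-≢ (inj₁ (refl , refl)) e = var e
    pair-≢ (inj₂ (refl , refl)) e = var (sym e)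

    pair-αβ₁ : ∀ {x y} → Pair x y → αβ x
    pair-αβ₁ (inj₁ (p , _)) = inj₁ p
    pair-αβ₁ (inj₂ (p , _)) = inj₂ p

    pair-αβ₂ : ∀ {x y} → Pair x y → αβ y
    pair-αβ₂ p = pair-αβ₁ (pair-sym p)

    pair-cases : ∀ {x y z} → Pair x y → αβ z → z ≡ x ⊎ z ≡ y
    pair-cases (inj₁ (refl , refl)) (inj₁ refl) = inj₁ refl
    pair-cases (inj₁ (refl , refl)) (inj₂ refl) = inj₂ refl
    pair-cases (inj₂ (refl , refl)) (inj₁ refl) = inj₂ refl
    pair-cases (inj₂ (refl , refl)) (inj₂ refl) = inj₁ refl

    pair-determined : ∀ {x y x' y'} → Pair x y → Pair x' y' → x ≡ x' → y ≡ y'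
    pair-determined (inj₁ (refl , refl)) (inj₁ (refl , refl)) _ = refl
    pair-determined (inj₁ (refl , refl)) (inj₂ (refl , refl)) e = contradiction e var
    pair-determined (inj₂ (refl , refl)) (inj₁ (refl , refl)) e = contradiction (sym e) var
    pair-determined (inj₂ (refl , refl)) (inj₂ (refl , refl)) _ = refl

    -- The state of the search from the src end of k: it stands at  vertex, which it
    -- entered through the link  entry  (coloured  other) and must leave by a link
    -- coloured  needed.
    record Frontier : Set where
      constructor frontier
      field
        vertex        : Fin n
        needed other  : Col
        visited       : List (Fin n)
        traversed     : List (Fin m)
        entry         : Link m
    open Frontier

    OnPath : List (Fin m) → Link m → Set
    OnPath Es l = l ≡ (k , src) ⊎ proj₁ l ∈ Es

    onPath-∷ : ∀ {f Es l} → OnPath Es l → OnPath (f ∷ Es) l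
    onPath-∷ (inj₁ e) = inj₁ e
    onPath-∷ (inj₂ q) = inj₂ (there q)

    record Explored (F : Frontier) : Set where
      field
        needed-other       : Pair (needed F) (other F)
        visited-closed     : ∀ {u} → u ∈ visited F → ∀ l → vtx G l ≡ u → αβ (c l) →
                             OnPath (traversed F) l
        onPath-visited     : ∀ l → OnPath (traversed F) l → vtx G l ∈ visited F ⊎ l ≡ entry F
        vertex-fresh       : vertex F ∉ visited F
        entry-vertex       : vtx G (entry F) ≡ vertex F
        entry-colour       : c (entry F) ≡ other F
        entry-onPath       : OnPath (traversed F) (entry F)
        visited-unique     : Unique (visited F)
        traversed-constant : ∀ g → g ∈ traversed F → c (g , src) ≡ c (g , tgt)
        traversed-αβ       : ∀ g → g ∈ traversed F → αβ (c (g , src))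
        visited-saturated  : ∀ {u} → u ∈ visited F → ∀ z → αβ z → ∃[ l ] (vtx G l ≡ u × c l ≡ z)
        k∉traversed        : k ∉ traversed F
        traversed-unique   : Unique (traversed F)

    start : Frontier
    start = frontier (ends G k src) β α [] [] (k , src)

    start-explored : Explored start
    start-explored = record
      { needed-other       = inj₂ (refl , refl)
      ; visited-closed     = λ ()
      ; onPath-visited     = λ { l (inj₁ e) → inj₂ e ; l (inj₂ ()) }
      ; vertex-fresh       = λ ()
      ; entry-vertex       = refl
      ; entry-colour       = refl
      ; entry-onPath       = inj₁ refl
      ; visited-unique     = []
      ; traversed-constant = λ _ ()
      ; traversed-αβ       = λ _ ()
      ; visited-saturated  = λ ()
      ; k∉traversed        = λ ()
      ; traversed-unique   = [] }

    visited-bound : ∀ {F} → Explored F → suc (length (visited F)) ≤ n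
    visited-bound E = unique⇒length≤ (¬Any⇒All¬ _ vertex-fresh ∷ visited-unique)
      where open Explored E

    traversed-bound : ∀ {F} → Explored F → suc (length (traversed F)) ≤ m
    traversed-bound E = unique⇒length≤ (¬Any⇒All¬ _ k∉traversed ∷ traversed-unique)
      where open Explored E

    module _ {F : Frontier} (E : Explored F) where
      open Explored E

      needed-unexplored : ∀ l → vtx G l ≡ vertex F → c l ≡ needed F → ¬ OnPath (traversed F) l
      needed-unexplored l ev ec on with onPath-visited l on
      ... | inj₁ q    = vertex-fresh (subst (_∈ visited F) ev q)
      ... | inj₂ refl = pair-≢ needed-other (trans (sym ec) entry-colour)

      explored-step : ∀ f s → ends G f s ≡ vertex F → c (f , s) ≡ needed F → f ≢ k →
                      c (f , flip s) ≡ needed F →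
                      Explored (frontier (ends G f (flip s)) (other F) (needed F)
                                         (vertex F ∷ visited F) (f ∷ traversed F) (f , flip s))
      explored-step f s ev ec f≢k ec' = record
        { needed-other       = pair-sym needed-other
        ; visited-closed     = closed
        ; onPath-visited     = onPath
        ; vertex-fresh       = fresh
        ; entry-vertex       = refl
        ; entry-colour       = ec'
        ; entry-onPath       = inj₂ (here refl)
        ; visited-unique     = ¬Any⇒All¬ _ vertex-fresh ∷ visited-unique
        ; traversed-constant = constant
        ; traversed-αβ       = coloured
        ; visited-saturated  = saturated
        ; k∉traversed        = k∉
        ; traversed-unique   = ¬Any⇒All¬ _ f∉ ∷ traversed-unique }
        where
        f∉ : f ∉ traversed F
        f∉ q = needed-unexplored (f , s) ev ec (inj₂ q)

        closed : ∀ {u} → u ∈ vertex F ∷ visited F → ∀ l → vtx G l ≡ u → αβ (c l) →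
                 OnPath (f ∷ traversed F) l
        closed (here refl) l el cl with pair-cases needed-other cl
        ... | inj₁ e rewrite link-unique l (f , s) (trans el (sym ev)) (trans e (sym ec)) =
          inj₂ (here refl)
        ... | inj₂ e
          rewrite link-unique l (entry F) (trans el (sym entry-vertex)) (trans e (sym entry-colour)) =
          onPath-∷ entry-onPath
        closed (there q) l el cl = onPath-∷ (visited-closed q l el cl)

        onPath : ∀ l → OnPath (f ∷ traversed F) l → vtx G l ∈ vertex F ∷ visited F ⊎ l ≡ (f , flip s)
        onPath l (inj₁ e) with onPath-visited l (inj₁ e)
        ... | inj₁ q    = inj₁ (there q)
        ... | inj₂ refl = inj₁ (here entry-vertex)
        onPath (g , t) (inj₂ (here refl)) with side-cases s t
        ... | inj₁ refl = inj₁ (here ev)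
        ... | inj₂ refl = inj₂ refl
        onPath l (inj₂ (there q)) with onPath-visited l (inj₂ q)
        ... | inj₁ q'   = inj₁ (there q')
        ... | inj₂ refl = inj₁ (here entry-vertex)

        fresh : ends G f (flip s) ∉ vertex F ∷ visited F
        fresh (here e) = loopless f s (trans e (sym ev))
        fresh (there q) with visited-closed q (f , flip s) refl
                               (pair-αβ₁ (subst (λ z → Pair z (other F)) (sym ec') needed-other))
        ... | inj₁ e  = f≢k (cong proj₁ e)
        ... | inj₂ q' = f∉ q'

        constant : ∀ g → g ∈ f ∷ traversed F → c (g , src) ≡ c (g , tgt)
        constant g (here refl) = both-sides⇒constant f s ec ec'
        constant g (there q)   = traversed-constant g q

        coloured : ∀ g → g ∈ f ∷ traversed F → αβ (c (g , src))
        coloured g (here refl) = subst αβ (sym (both-sides⇒src f s ec ec')) (pair-αβ₁ needed-other)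
        coloured g (there q)   = traversed-αβ g q

        saturated : ∀ {u} → u ∈ vertex F ∷ visited F → ∀ z → αβ z →
                    ∃[ l ] (vtx G l ≡ u × c l ≡ z)
        saturated (here refl) z cz with pair-cases needed-other cz
        ... | inj₁ refl = (f , s) , ev , ec
        ... | inj₂ refl = entry F , entry-vertex , entry-colour
        saturated (there q) z cz = visited-saturated q z cz

        k∉ : k ∉ f ∷ traversed F
        k∉ (here e)  = f≢k (sym e)
        k∉ (there q) = k∉traversed q

    data PathEnd (F : Frontier) : Maybe (Link m) → Set where
      needed-missing : (∀ l → vtx G l ≡ vertex F → c l ≢ needed F) → PathEnd F nothing
      leaves-open    : ∀ f s → ends G f s ≡ vertex F → c (f , s) ≡ needed F → f ≢ k →
                       c (f , flip s) ≢ needed F → PathEnd F (just (f , s))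

    -- Each step adds two links to T and one vertex to visited, and visited has fewer than n vertices.
    WithinBudget : Frontier → List (Link m) → Set
    WithinBudget F T = length T + (length (visited F) + length (visited F)) < n + n

    Swept : Frontier → Maybe (Link m) → Link m → Set
    Swept F exit l = OnPath (traversed F) l ⊎ exit ≡ just l

    record Opened (F : Frontier) (T : List (Link m)) : Set where
      field
        final          : Frontier
        exit           : Maybe (Link m)
        final-explored : Explored final
        final-end      : PathEnd final exit
        onPath-grows   : ∀ l → OnPath (traversed F) l → OnPath (traversed final) l
        T⊆swept    : ∀ l → l ∈ T → Swept final exit l
        swept⊆T    : ∀ l → Swept final exit l → l ∈ T ⊎ OnPath (traversed F) l
        budget         : WithinBudget F T

    record Closed (F : Frontier) (T : List (Link m)) : Set where
      field
        final          : Frontier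
        final-explored : Explored final
        at-k-tgt       : vtx G (k , tgt) ≡ vertex final
        needs-β        : β ≡ needed final
        budget         : WithinBudget F T

    SearchResult : Frontier → Outcome → List (Link m) → Set
    SearchResult F reduce T = Opened F T
    SearchResult F cycle  T = Closed F T
    SearchResult F stuck  T = ⊥

    budget-here : ∀ {F} → Explored F → WithinBudget F []
    budget-here {F} E = ℕ.<-≤-trans (ℕ.+-monoˡ-< v bound) (ℕ.+-monoʳ-≤ n (ℕ.<⇒≤ bound))
      where
      v = length (visited F)
      bound = visited-bound E

    budget-exit : ∀ {F} l → Explored F → WithinBudget F (l ∷ [])
    budget-exit {F} l E = subst (_≤ n + n) (cong suc (ℕ.+-suc v v)) (ℕ.+-mono-≤ bound bound)
      where
      v = length (visited F)
      bound = visited-bound E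

    budget-step : ∀ {t v} → t + (suc v + suc v) < n + n → suc (suc t) + (v + v) < n + n
    budget-step {t} {v} = subst (_< n + n) (two-steps t v)
      where
      two-steps : ∀ t v → t + (suc v + suc v) ≡ suc (suc t) + (v + v)
      two-steps = solve-∀

    search-cycle-at-k : ∀ {F} → Explored F → ∀ s → vtx G (k , s) ≡ vertex F → c (k , s) ≡ needed F →
                        vtx G (k , tgt) ≡ vertex F × β ≡ needed F
    search-cycle-at-k E src ev ec = contradiction (inj₁ refl) (needed-unexplored E (k , src) ev ec)
    search-cycle-at-k E tgt ev ec = ev , ec

    extend-result : ∀ {F} (E : Explored F) f s o T →
                    SearchResult (frontier (ends G f (flip s)) (other F) (needed F)
                                           (vertex F ∷ visited F) (f ∷ traversed F) (f , flip s)) o T →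
                    SearchResult F o ((f , s) ∷ (f , flip s) ∷ T)
    extend-result {F} E f s reduce T R = record
      { final = final ; exit = exit ; final-explored = final-explored ; final-end = final-end
      ; onPath-grows = λ l on → onPath-grows l (onPath-∷ on)
      ; T⊆swept  = swept
      ; swept⊆T  = links
      ; budget       = budget-step budget }
      where
      open Opened R
      swept : ∀ l → l ∈ (f , s) ∷ (f , flip s) ∷ T → Swept final exit l
      swept l (here refl)         = inj₁ (onPath-grows _ (inj₂ (here refl)))
      swept l (there (here refl)) = inj₁ (onPath-grows _ (inj₂ (here refl)))
      swept l (there (there q))   = T⊆swept l q
      links : ∀ l → Swept final exit l → l ∈ (f , s) ∷ (f , flip s) ∷ T ⊎ OnPath (traversed F) l
      links l sw with swept⊆T l sw
      ... | inj₁ q                = inj₁ (there (there q))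
      ... | inj₂ (inj₁ e)         = inj₂ (inj₁ e)
      ... | inj₂ (inj₂ (there q)) = inj₂ (inj₂ q)
      links (g , t) sw | inj₂ (inj₂ (here refl)) with side-cases s t
      ... | inj₁ refl = inj₁ (here refl)
      ... | inj₂ refl = inj₁ (there (here refl))
    extend-result E f s cycle T R = record { Closed R ; budget = budget-step (Closed.budget R) }
    extend-result E f s stuck T ()

    -- The fuel  suc m  suffices: the traversed edges are distinct and differ from k.
    search-sound : ∀ fu F → Explored F → fu + length (traversed F) ≡ suc m →
                   ∀ {o T} → search fu c k (vertex F) (needed F) (other F) ≡ (o , T) → SearchResult F o T
    search-sound zero F E fuel refl =
      ℕ.1+n≰n (ℕ.≤-trans (ℕ.n≤1+n (suc m)) (subst (λ x → suc x ≤ m) fuel (traversed-bound E)))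
    search-sound (suc fu) F E fuel eq with findLink c (vertex F) (needed F) in found
    ... | nothing with refl ← eq = record
      { final = F ; exit = nothing ; final-explored = E
      ; final-end    = needed-missing (findLink-nothing (vertex F) (needed F) found)
      ; onPath-grows = λ _ on → on
      ; T⊆swept  = λ _ ()
      ; swept⊆T  = λ { _ (inj₁ on) → inj₂ on ; _ (inj₂ ()) }
      ; budget       = budget-here E }
    ... | just (f , s) with findLink-just (vertex F) (needed F) found
    ...   | ev , ec with f Finₚ.≟ k
    ...     | yes refl with refl ← eq =
      let at-k , needs = search-cycle-at-k E s ev ec in
      record { final = F ; final-explored = E ; at-k-tgt = at-k ; needs-β = needs ; budget = budget-here E }
    ...     | no f≢k with c (f , flip s) Finₚ.≟ needed F
    ...       | no open-end with refl ← eq = record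
      { final = F ; exit = just (f , s) ; final-explored = E
      ; final-end    = leaves-open f s ev ec f≢k open-end
      ; onPath-grows = λ _ on → on
      ; T⊆swept  = λ { _ (here refl) → inj₂ refl }
      ; swept⊆T  = λ { _ (inj₁ on) → inj₂ on ; _ (inj₂ refl) → inj₁ (here refl) }
      ; budget       = budget-exit (f , s) E }
    ...       | yes constant with search fu c k (ends G f (flip s)) (other F) (needed F) in rest
    ...         | o , T with refl ← eq =
      extend-result E f s o T
        (search-sound fu _ (explored-step E f s ev ec f≢k constant) (trans (ℕ.+-suc fu _) fuel) rest)

    reach-avoids-k : ∀ {w b a} → ReachEnd G c k w b a → ∀ s → ends G k s ≡ w → c (k , s) ≡ b → ⊥
    reach-avoids-k (missing h) s ev ec = h (k , s) ev ec
    reach-avoids-k (openEnd g t e1 e2 g≢k _) s ev ec =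
      g≢k (cong proj₁ (link-unique (g , t) (k , s) (trans e1 (sym ev)) (trans e2 (sym ec))))
    reach-avoids-k (step g t e1 e2 g≢k _ _) s ev ec =
      g≢k (cong proj₁ (link-unique (g , t) (k , s) (trans e1 (sym ev)) (trans e2 (sym ec))))

    -- A ReachEnd walk follows exactly the links the search follows, since a colour occurs
    -- at most once at each vertex.
    cycle⇒¬ReachEnd : ∀ fu w b a {T} → search fu c k w b a ≡ (cycle , T) → ¬ ReachEnd G c k w b a
    cycle⇒¬ReachEnd zero w b a () r
    cycle⇒¬ReachEnd (suc fu) w b a eq r with findLink c w b in found
    cycle⇒¬ReachEnd (suc fu) w b a () r | nothing
    ... | just (f , s) with findLink-just w b found | f Finₚ.≟ k
    ...   | ev , ec | yes refl = reach-avoids-k r s ev ec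
    ...   | ev , ec | no _ with c (f , flip s) Finₚ.≟ b
    cycle⇒¬ReachEnd (suc fu) w b a () r | just (f , s) | ev , ec | no _ | no _
    ... | yes constant with search fu c k (ends G f (flip s)) a b in rest
    ...   | o , T with refl ← eq with r
    ...     | missing h = h (f , s) ev ec
    ...     | openEnd g t e1 e2 _ open-end
              with refl ← link-unique (g , t) (f , s) (trans e1 (sym ev)) (trans e2 (sym ec)) =
      open-end constant
    ...     | step g t e1 e2 _ _ r'
              with refl ← link-unique (g , t) (f , s) (trans e1 (sym ev)) (trans e2 (sym ec)) =
      cycle⇒¬ReachEnd fu _ a b rest r'

    traversed-off-k : ∀ {Es g t} → g ≢ k → OnPath Es (g , t) ⊎ (g , t) ≡ (k , tgt) → g ∈ Es
    traversed-off-k g≢k (inj₁ (inj₁ e)) = contradiction (cong proj₁ e) g≢k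
    traversed-off-k g≢k (inj₁ (inj₂ q)) = q
    traversed-off-k g≢k (inj₂ e)        = contradiction (cong proj₁ e) g≢k

    -- Once the search is back at k the whole chain is explored: a walk along it meets only
    -- constant edges and vertices carrying both colours, so it can never end.
    module _ {F : Frontier} (E : Explored F)
             (at-k : vtx G (k , tgt) ≡ vertex F) (needs : β ≡ needed F) where
      open Explored E

      closed⇒¬ReachEnd : ∀ {u x y} → Pair x y → ReachEnd G c k u x y →
                         ∀ l → vtx G l ≡ u → c l ≡ x → OnPath (traversed F) l ⊎ l ≡ (k , tgt) → ⊥
      closed⇒¬ReachEnd p (missing h) l ev ec on = h l ev ec
      closed⇒¬ReachEnd p (openEnd g t e1 e2 g≢k open-end) l ev ec on
        with refl ← link-unique (g , t) l (trans e1 (sym ev)) (trans e2 (sym ec)) =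
        open-end (trans (constant-flip g t (traversed-constant g (traversed-off-k g≢k on))) e2)
      closed⇒¬ReachEnd {y = y} p (step g t e1 e2 g≢k e3 rest) l ev ec on
        with refl ← link-unique (g , t) l (trans e1 (sym ev)) (trans e2 (sym ec))
           | onPath-visited (g , flip t) (inj₂ (traversed-off-k g≢k on))
      ... | inj₁ q with visited-saturated q y (pair-αβ₂ p)
      ...   | l' , ev' , ec' = closed⇒¬ReachEnd (pair-sym p) rest l' ev' ec'
                                 (inj₁ (visited-closed q l' ev' (subst αβ (sym ec') (pair-αβ₂ p))))
      closed⇒¬ReachEnd {y = y} p (step g t e1 e2 g≢k e3 rest) l ev ec on | inj₂ e =
        closed⇒¬ReachEnd (pair-sym p) rest (k , tgt)
          (trans at-k (sym (trans (cong (vtx G) e) entry-vertex))) (trans needs (sym y≡needed)) (inj₂ refl)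
        where
        y≡needed = pair-determined p (pair-sym needed-other) (trans (sym e3) (trans (cong c e) entry-colour))

    search-from-k : ∀ {o T} → search (suc m) c k (ends G k src) β α ≡ (o , T) → SearchResult start o T
    search-from-k = search-sound (suc m) start start-explored (ℕ.+-identityʳ (suc m))

    cycle⇒irreducible : ∀ {T} → search (suc m) c k (ends G k src) β α ≡ (cycle , T) → ¬ Reducible G c k
    cycle⇒irreducible eq (inj₁ r) = cycle⇒¬ReachEnd (suc m) _ _ _ eq r
    cycle⇒irreducible eq (inj₂ r) =
      closed⇒¬ReachEnd final-explored at-k-tgt needs-β (inj₁ (refl , refl)) r (entry final)
        (trans entry-vertex (sym at-k-tgt))
        (trans entry-colour (pair-determined needed-other (inj₂ (refl , refl)) (sym needs-β)))
        (inj₁ entry-onPath)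
      where
      open Closed (search-from-k eq)
      open Explored final-explored

    swap : Col → Col
    swap z = if z ≟C α then β else (if z ≟C β then α else z)

    swap-α : swap α ≡ β
    swap-α rewrite dec-true (α Finₚ.≟ α) refl = refl

    swap-β : swap β ≡ α
    swap-β rewrite dec-false (β Finₚ.≟ α) (var ∘ sym) | dec-true (β Finₚ.≟ β) refl = refl

    αβ-swap : ∀ {z} → αβ z → αβ (swap z)
    αβ-swap (inj₁ refl) = inj₂ swap-α
    αβ-swap (inj₂ refl) = inj₁ swap-β

    swap-injective : ∀ {z z'} → αβ z → αβ z' → swap z ≡ swap z' → z ≡ z'
    swap-injective (inj₁ refl) (inj₁ refl) _ = refl
    swap-injective (inj₂ refl) (inj₂ refl) _ = refl
    swap-injective (inj₁ refl) (inj₂ refl) e = ⊥-elim (var (trans (sym swap-β) (trans (sym e) swap-α)))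
    swap-injective (inj₂ refl) (inj₁ refl) e = ⊥-elim (var (trans (sym swap-β) (trans e swap-α)))

    swap-≢ : ∀ {z} → αβ z → swap z ≢ z
    swap-≢ (inj₁ refl) e = var (trans (sym e) swap-α)
    swap-≢ (inj₂ refl) e = var (trans (sym swap-β) e)

    exchange-∈ : ∀ {P l} → l ∈ P → exchange α β P c l ≡ swap (c l)
    exchange-∈ {P} {l} l∈P with any (_≟L l) P | Equivalence.to ∈⇔any-≟L l∈P
    ... | true | _ = refl

    exchange-∉ : ∀ {P l} → l ∉ P → exchange α β P c l ≡ c l
    exchange-∉ {P} {l} l∉P with any (_≟L l) P in e
    ... | false = refl
    ... | true  = contradiction (Equivalence.from ∈⇔any-≟L (subst T (sym e) _)) l∉P

    αβ-both-sides : ∀ g t → αβ (c (g , src)) → c (g , src) ≡ c (g , tgt) → αβ (c (g , t))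
    αβ-both-sides g src cg _ = cg
    αβ-both-sides g tgt cg e = subst αβ e cg

    module Exchange {T : List (Link m)} (R : Opened start T) where
      open Opened R
      open Explored final-explored

      P : List (Link m)
      P = (k , src) ∷ T

      c' : Config G
      c' = exchange α β P c

      Moved : Link m → Set
      Moved = Swept final exit

      ∈P⇒moved : ∀ l → l ∈ P → Moved l
      ∈P⇒moved l (here refl) = inj₁ (inj₁ refl)
      ∈P⇒moved l (there q)   = T⊆swept l q

      moved⇒∈P : ∀ l → Moved l → l ∈ P
      moved⇒∈P l mv with swept⊆T l mv
      ... | inj₁ q             = there q
      ... | inj₂ (inj₁ refl)   = here refl

      exchanged : ∀ l → (Moved l × c' l ≡ swap (c l)) ⊎ (¬ Moved l × c' l ≡ c l)
      exchanged l with Any.any? (l ≟Link_) P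
      ... | yes l∈P = inj₁ (∈P⇒moved l l∈P , exchange-∈ l∈P)
      ... | no  l∉P = inj₂ (l∉P ∘ moved⇒∈P l , exchange-∉ l∉P)

      exit-αβ : ∀ {ex l} → PathEnd final ex → ex ≡ just l → αβ (c l)
      exit-αβ (leaves-open f s _ ec _ _) refl = subst αβ (sym ec) (pair-αβ₁ needed-other)

      exit-variable : ∀ {ex g t} → PathEnd final ex → ex ≡ just (g , t) → Variable G c g
      exit-variable (leaves-open f s _ ec _ open-end) refl eq = open-end (trans (constant-flip f s eq) ec)

      exit-off-k : ∀ {ex g t} → PathEnd final ex → ex ≡ just (g , t) → g ≢ k
      exit-off-k (leaves-open f s _ _ f≢k _) refl = f≢k

      -- The links of colour needed/other at the exit vertex are the exit and the entry.
      exit-closed : ∀ {ex l} → PathEnd final ex → ex ≡ just l →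
                    ∀ l' → vtx G l' ≡ vtx G l → αβ (c l') → c l' ≢ c l → Moved l'
      exit-closed (leaves-open f s ev ec _ _) refl l' el cl ne with pair-cases needed-other cl
      ... | inj₁ needed = contradiction (trans needed (sym ec)) ne
      ... | inj₂ other  = inj₁ (subst (OnPath (traversed final))
                                  (link-unique (entry final) l' (trans entry-vertex (sym (trans el ev)))
                                               (trans entry-colour (sym other)))
                                  entry-onPath)

      needed-at-end : ∀ {ex} → PathEnd final ex → ∀ l → vtx G l ≡ vertex final → c l ≡ needed final →
                      Swept final ex l
      needed-at-end (needed-missing h)          l el cl = contradiction cl (h l el)
      needed-at-end (leaves-open f s ev ec _ _) l el cl =
        inj₂ (cong just (link-unique (f , s) l (trans ev (sym el)) (trans ec (sym cl))))

      moved-αβ : ∀ {l} → Moved l → αβ (c l)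
      moved-αβ (inj₁ (inj₁ refl))     = inj₁ refl
      moved-αβ {g , t} (inj₁ (inj₂ q)) = αβ-both-sides g t (traversed-αβ g q) (traversed-constant g q)
      moved-αβ (inj₂ e)               = exit-αβ final-end e

      moved-closed : ∀ {l} → Moved l → ∀ l' → vtx G l' ≡ vtx G l → αβ (c l') → c l' ≢ c l → Moved l'
      moved-closed {l} (inj₁ on) l' el cl ne with onPath-visited l on
      ... | inj₁ q    = inj₁ (visited-closed q l' el cl)
      ... | inj₂ refl with pair-cases needed-other cl
      ...   | inj₁ needed = needed-at-end final-end l' (trans el entry-vertex) needed
      ...   | inj₂ other  = contradiction (trans other (sym entry-colour)) ne
      moved-closed (inj₂ e) = exit-closed final-end e

      -- A link that keeps its colour and meets a swapped colour would have been swapped too.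
      exchange-consistent : Consistent G c'
      exchange-consistent l l' l≢l' el eq with exchanged l | exchanged l'
      ... | inj₁ (mv , e) | inj₁ (mv' , e') =
        consistent l l' l≢l' el
          (swap-injective (moved-αβ mv) (moved-αβ mv') (trans (sym e) (trans eq e')))
      ... | inj₂ (_ , e)  | inj₂ (_ , e')   = consistent l l' l≢l' el (trans (sym e) (trans eq e'))
      ... | inj₁ (mv , e) | inj₂ (¬mv' , e') =
        let d = trans (sym e') (trans (sym eq) e) in
        ¬mv' (moved-closed mv l' (sym el) (subst αβ (sym d) (αβ-swap (moved-αβ mv)))
                                          (λ h → swap-≢ (moved-αβ mv) (trans (sym d) h)))
      ... | inj₂ (¬mv , e) | inj₁ (mv' , e') =
        let d = trans (sym e) (trans eq e') in
        ¬mv (moved-closed mv' l el (subst αβ (sym d) (αβ-swap (moved-αβ mv')))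
                                   (λ h → swap-≢ (moved-αβ mv') (trans (sym d) h)))

      moved-other-side : ∀ g t → c (g , src) ≡ c (g , tgt) → Moved (g , t) → Moved (g , flip t)
      moved-other-side g t eq (inj₁ (inj₁ refl)) = contradiction eq var
      moved-other-side g t eq (inj₁ (inj₂ q))    = inj₁ (inj₂ q)
      moved-other-side g t eq (inj₂ e)           = contradiction eq (exit-variable final-end e)

      constant-stays : ∀ g → c (g , src) ≡ c (g , tgt) → c' (g , src) ≡ c' (g , tgt)
      constant-stays g eq with exchanged (g , src) | exchanged (g , tgt)
      ... | inj₁ (_ , e)   | inj₁ (_ , e')   = trans e (trans (cong swap eq) (sym e'))
      ... | inj₂ (_ , e)   | inj₂ (_ , e')   = trans e (trans eq (sym e'))
      ... | inj₁ (mv , _)  | inj₂ (¬mv , _)  = contradiction (moved-other-side g src eq mv) ¬mv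
      ... | inj₂ (¬mv , _) | inj₁ (mv , _)   = contradiction (moved-other-side g tgt eq mv) ¬mv

      k-tgt-unmoved : ¬ Moved (k , tgt)
      k-tgt-unmoved (inj₁ (inj₁ ()))
      k-tgt-unmoved (inj₁ (inj₂ q)) = k∉traversed q
      k-tgt-unmoved (inj₂ e)        = exit-off-k final-end e refl

      k-becomes-constant : c' (k , src) ≡ c' (k , tgt)
      k-becomes-constant =
        trans (exchange-∈ {P} (here refl)) (trans swap-α (sym (exchange-∉ (k-tgt-unmoved ∘ ∈P⇒moved _))))

      fewer-variables : length (variables c') < length (variables c)
      fewer-variables =
        length-filterᵇ-< _ _
          (λ g → not-does-mono (c' (g , src) Finₚ.≟ c' (g , tgt)) (c (g , src) Finₚ.≟ c (g , tgt))
                               (constant-stays g))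
          (lose (∈-allFin k)
                (not-does-< (c' (k , src) Finₚ.≟ c' (k , tgt)) (c (k , src) Finₚ.≟ c (k , tgt))
                            k-becomes-constant var))

    Searched : Outcome → List (Link m) → Set
    Searched reduce P = Consistent G (exchange α β P c) ×
                        length (variables (exchange α β P c)) < length (variables c)
    Searched cycle  P = ¬ Reducible G c k
    Searched stuck  P = ⊥

    budget-at-start : ∀ T → WithinBudget start T → suc (length T) ≤ n + n
    budget-at-start T = subst (λ x → suc x ≤ n + n) (ℕ.+-identityʳ (length T))

    search-spec : ∀ {o T} → search (suc m) c k (ends G k src) β α ≡ (o , T) →
                  suc (length T) ≤ n + n × Searched o ((k , src) ∷ T)
    search-spec {reduce} {T} eq = budget-at-start T budget , exchange-consistent , fewer-variables
      where
      R = search-from-k eq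
      open Opened R using (budget)
      open Exchange R
    search-spec {cycle}  {T} eq = budget-at-start T (Closed.budget (search-from-k eq)) , cycle⇒irreducible eq
    search-spec {stuck}  eq = ⊥-elim (search-from-k eq)

searchCost : ℕ → ℕ
searchCost n = suc ((n + n) + (n + n))

roundCost : ℕ → ℕ → ℕ
roundCost n m = m + m * searchCost n

module MainLoop {n m} (G : Graph n m) (simple : Simple G) where
  open WKP G

  isVariable : Config G → Fin m → Bool
  isVariable c g = not (c (g , src) ≟C c (g , tgt))

  variables≤m : ∀ c → length (variables c) ≤ m
  variables≤m c =
    subst (length (variables c) ≤_) (length-tabulate id) (length-filter (T? ∘ isVariable c) (allFin m))

  variables-complete : ∀ c {ks} → variables c ≡ ks → ∀ {g} → Variable G c g → g ∈ ks
  variables-complete c refl {g} var =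
    ∈-filter⁺ (T? ∘ isVariable c) (∈-allFin g) (T-not-does⁺ (c (g , src) Finₚ.≟ c (g , tgt)) var)

  variables-sound : ∀ c {ks} → variables c ≡ ks → ∀ g → g ∈ ks → Variable G c g
  variables-sound c refl g g∈ =
    T-not-does⁻ (c (g , src) Finₚ.≟ c (g , tgt))
                (proj₂ (∈-filter⁻ (T? ∘ isVariable c) {xs = allFin m} g∈))

  variables-length : ∀ c {ks} → variables c ≡ ks → length ks ≤ m
  variables-length c refl = variables≤m c

  searchVar-≡ : ∀ c k → searchVar c k ≡
                (proj₁ (search (suc m) c k (ends G k src) (c (k , tgt)) (c (k , src))) ,
                 (k , src) ∷ proj₂ (search (suc m) c k (ends G k src) (c (k , tgt)) (c (k , src))))
  searchVar-≡ c k with search (suc m) c k (ends G k src) (c (k , tgt)) (c (k , src))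
  ... | _ = refl

  searchVar-spec : ∀ c (cons : Consistent G c) k (var : Variable G c k) {o P} → searchVar c k ≡ (o , P) →
                   length P ≤ n + n × Kempe.Walk.Searched G simple c cons k var o P
  searchVar-spec c cons k var eq
    with search (suc m) c k (ends G k src) (c (k , tgt)) (c (k , src)) in found | searchVar-≡ c k
  ... | o , T | sv with refl ← trans (sym sv) eq = Kempe.Walk.search-spec G simple c cons k var found

  Tried : Config G → List (Fin m) → Maybe (Config G) → Set
  Tried c ks nothing   = ∀ k → k ∈ ks → ¬ Reducible G c k
  Tried c ks (just c') = Consistent G c' × length (variables c') < length (variables c)

  tried-∷ : ∀ {c k ks} r → ¬ Reducible G c k → Tried c ks r → Tried c (k ∷ ks) r
  tried-∷ nothing  irreducible tried _ (here refl) = irreducible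
  tried-∷ nothing  irreducible tried k (there k∈)  = tried k k∈
  tried-∷ (just _) _           tried = tried

  searchVar-cost : ∀ (P : List (Link m)) → length P ≤ n + n → suc (length P) + length P ≤ searchCost n
  searchVar-cost P ≤2n = s≤s (ℕ.+-mono-≤ ≤2n ≤2n)

  tryList-spec : ∀ c → Consistent G c → ∀ ks → (∀ k → k ∈ ks → Variable G c k) →
                 ∀ {r t} → tryList c ks ≡ (r , t) → t ≤ length ks * searchCost n × Tried c ks r
  tryList-spec c cons [] vars refl = z≤n , λ _ ()
  tryList-spec c cons (k ∷ ks) vars eq with searchVar c k in found
  ... | reduce , P with refl ← eq =
    let ≤2n , reduced = searchVar-spec c cons k (vars k (here refl)) found
    in ℕ.≤-trans (searchVar-cost P ≤2n) (ℕ.m≤m+n _ _) , reduced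
  ... | stuck , P = ⊥-elim (proj₂ (searchVar-spec c cons k (vars k (here refl)) found))
  ... | cycle , P with tryList c ks in rest
  ...   | r , t with refl ← eq =
    let ≤2n , irreducible = searchVar-spec c cons k (vars k (here refl)) found
        t≤ , tried = tryList-spec c cons ks (λ k' k'∈ → vars k' (there k'∈)) rest
    in ℕ.+-mono-≤ (s≤s (ℕ.≤-trans ≤2n (ℕ.m≤m+n (n + n) (n + n)))) t≤ , tried-∷ r irreducible tried

  round-cost : ∀ {ℓ t} → ℓ ≤ m → t ≤ ℓ * searchCost n → m + t ≤ roundCost n m
  round-cost ≤m t≤ = ℕ.+-monoʳ-≤ m (ℕ.≤-trans t≤ (ℕ.*-monoˡ-≤ (searchCost n) ≤m))

  Finished : Config G → Set
  Finished out = Proper G out ⊎ Canonical G out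

  run-spec : ∀ fu c → Consistent G c → length (variables c) < fu →
             ∃[ out ] ∃[ t ] (run fu c ≡ just (out , t) ×
                              t ≤ suc (length (variables c)) * roundCost n m × Finished out)
  run-spec (suc fu) c cons vars<fu with variables c in vs
  ... | [] = c , m , refl , ℕ.≤-trans (ℕ.m≤m+n m _) (ℕ.m≤m+n _ 0) ,
             inj₁ (cons , λ g var → contradiction (variables-complete c vs var) λ ())
  ... | k ∷ ks with tryList c (k ∷ ks) in tried
  ...   | nothing , t =
    let t≤ , irreducible = tryList-spec c cons (k ∷ ks) (variables-sound c vs) tried
    in c , m + t , refl , ℕ.≤-trans (round-cost (variables-length c vs) t≤) (ℕ.m≤m+n _ _) ,
       inj₂ (cons , λ g var → irreducible g (variables-complete c vs var))
  ...   | just c' , t =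
    let t≤ , cons' , fewer = tryList-spec c cons (k ∷ ks) (variables-sound c vs) tried
        fewer′ = subst (λ ks → length (variables c') < length ks) vs fewer
        out , t' , ran , t'≤ , finished = run-spec fu c' cons' (ℕ.<-≤-trans fewer′ (ℕ.≤-pred vars<fu))
    in out , m + t + t' , cong (addCost (m + t)) ran ,
       ℕ.+-mono-≤ (round-cost (variables-length c vs) t≤)
                  (ℕ.≤-trans t'≤ (ℕ.*-monoˡ-≤ (roundCost n m) fewer′)) ,
       finished

work-bound : ∀ {n m} → Graph n m → suc m * roundCost n m ≤ 12 * (n * (m * m))
work-bound {m = zero} _ = z≤n
work-bound {zero} {suc m} G = ⊥-elim (Finₚ.¬Fin0 (ends G fzero src))
work-bound {suc n} {suc m} _ = begin
  suc M * roundCost N M           ≡⟨ factor M N ⟩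
  (1 + M) * M * (4 * N + 2)       ≤⟨ ℕ.*-mono-≤ (ℕ.*-monoˡ-≤ M (ℕ.+-monoˡ-≤ M (s≤s (z≤n {m}))))
                                                (ℕ.+-monoʳ-≤ (4 * N) (ℕ.*-monoʳ-≤ 2 (s≤s z≤n))) ⟩
  (M + M) * M * (4 * N + 2 * N)   ≡⟨ regroup M N ⟩
  12 * (N * (M * M))              ∎
  where
  open ℕ.≤-Reasoning
  M = suc m
  N = suc n
  factor : ∀ m n → suc m * (m + m * suc ((n + n) + (n + n))) ≡ (1 + m) * m * (4 * n + 2)
  factor = solve-∀
  regroup : ∀ m n → (m + m) * m * (4 * n + 2 * n) ≡ 12 * (n * (m * m))
  regroup = solve-∀

theorem1 : ∃[ C ] (∀ {n m} (G : Graph n m) → Simple G →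
             (c : Config G) → Consistent G c →
             ∃[ fuel ] ∃[ out ] ∃[ t ]
               (WKP.run G fuel c ≡ just (out , t)) ×
               (t ≤ C * (n * (m * m))) ×
               (Proper G out ⊎ Canonical G out))
theorem1 = 12 , λ {n} {m} G simple c cons →
  let open MainLoop G simple
      out , t , ran , t≤ , finished = run-spec (suc m) c cons (s≤s (variables≤m c))
  in suc m , out , t , ran ,
     ℕ.≤-trans t≤ (ℕ.≤-trans (ℕ.*-monoˡ-≤ (roundCost n m) (s≤s (variables≤m c)))
                             (work-bound G)) ,
     finished
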